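{- Let $G=(V,E)$ be a graph with $n$ vertices that contains no dominating set of cardinality smaller than $\frac{149}{300}n$. Then there exists a set $A\subseteq V$ such that: (1) $A$ is an independent set and the closed neighbourhoods $\{\bar N(v):v\in A\}$ are pairwise disjoint; (2) every vertex of $A$ has degree at most $6$; (3) $|A|\ge \frac{41}{9800}n$.
   Context: $\bar N(v)=\{v\}\cup\{u:uv\in E\}$ is the closed neighbourhood of $v$. A set $D\subseteq V$ is dominating if $\bigcup_{v\in D}\bar N(v)=V$. -}

module Defs where

open import Data.Nat using (ℕ)
open import Data.Fin using (Fin)
open import Data.Fin.Subset using (Subset; _∈_; ∣_∣)
open import Data.Vec using (tabulate)
open import Data.Bool using (Bool)
open import Data.Product using (_×_; ∃-syntax)
open import Data.Sum using (_⊎_)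
open import Relation.Nullary using (¬_; Dec)
open import Relation.Nullary.Decidable using (⌊_⌋)
open import Relation.Binary.PropositionalEquality using (_≡_)

record Graph (n : ℕ) : Set₁ where
  field
    Adj    : Fin n → Fin n → Set
    adj?   : (u v : Fin n) → Dec (Adj u v)
    sym    : ∀ {u v} → Adj u v → Adj v u
    irrefl : ∀ {u} → ¬ Adj u u

module _ {n : ℕ} (G : Graph n) where
  open Graph G

  N : Fin n → Subset n
  N v = tabulate (λ u → ⌊ adj? v u ⌋)

  degree : Fin n → ℕ
  degree v = ∣ N v ∣

  InClosedNbhd : Fin n → Fin n → Set
  InClosedNbhd w v = w ≡ v ⊎ Adj v w

  Dominating : Subset n → Set
  Dominating D = ∀ w → ∃[ v ] (v ∈ D × InClosedNbhd w v)

  Independent : Subset n → Set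
  Independent A = ∀ {u v} → u ∈ A → v ∈ A → ¬ Adj u v

  ClosedNbhdsDisjoint : Subset n → Set
  ClosedNbhdsDisjoint A =
    ∀ {u v} → u ∈ A → v ∈ A → ¬ u ≡ v →
      ∀ w → ¬ (InClosedNbhd w u × InClosedNbhd w v)

-- Let A be a maximal set of vertices of degree at most 6 whose closed neighbourhoods are
-- pairwise disjoint, and S = N̄[A], so |S| ≤ 7|A|. By maximality, every vertex not dominated
-- by S has degree at least 7. The undominated vertices U are dominated greedily: repeatedly
-- take a vertex whose closed neighbourhood contains at least 3 vertices of U still undominated,
-- then one containing at least 2, and finally the remaining vertices themselves. Double
-- counting degrees bounds what the first two phases leave: 7|U′| ≤ 2n and 7|U″| ≤ n, so the
-- greedy part costs at most 19n/42 vertices. The dominating set obtained has at most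
-- 7|A| + 19n/42 vertices, and comparing with 149n/300 gives |A| ≥ 31n/4900 ≥ 41n/9800.

module Submission where

open import Data.Bool using (Bool; true; if_then_else_; _∧_)
open import Data.Fin using (Fin; zero; suc)
open import Data.Fin.Properties using (any?)
open import Data.Fin.Subset
open import Data.Fin.Subset.Properties
open import Data.List using (List; []; _∷_; allFin)
import Data.List.Membership.Propositional as List
open import Data.List.Membership.Propositional.Properties using (∈-allFin)
open import Data.List.Relation.Unary.Any using (here; there)
open import Data.Nat using (ℕ; zero; suc; _≤_; _<_; _*_; _+_; z≤n; s≤s; _<?_; _≤?_)
open import Data.Nat.Induction using (<-wellFounded)
open import Data.Nat.Properties
open import Algebra.Properties.CommutativeMonoid.Sum +-0-commutativeMonoid
  using (sum; sum-syntax; ∑-comm; sum-cong-≗)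
open import Data.Nat.Tactic.RingSolver using (solve)
open import Data.Product using (∃-syntax; _×_; _,_; swap; map₂)
open import Data.Sum using (_⊎_; inj₁; inj₂)
import Data.Sum as Sum
open import Data.Vec using (lookup; tabulate; here; there)
open import Data.Vec.Properties
  using (lookup∘tabulate; lookup-zipWith; tabulate-cong; []=⇒lookup; lookup⇒[]=)
open import Function using (_∘_; id; mk⇔)
open import Induction.WellFounded using (Acc; acc)
open import Level using (_⊔_)
open import Relation.Binary using (Rel; Reflexive; Symmetric) renaming (Decidable to Decidable₂)
open import Relation.Binary.PropositionalEquality
open import Relation.Nullary using (¬_; yes; no; contradiction)
open import Relation.Nullary.Decidable using (⌊_⌋; does; _×-dec_; dec-true; does-⇔; isYes≗does)
open import Relation.Unary using (Pred; Decidable)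

open import Defs

private variable
  m n : ℕ

-- Cardinalities of subsets

-- The Vec constructors stay local: overloaded with List's they break the ring solver's
-- variable lists below.
module _ where
  open import Data.Vec using ([]; _∷_)

  ∣p∪q∣≤∣p∣+∣q∣ : ∀ (p q : Subset n) → ∣ p ∪ q ∣ ≤ ∣ p ∣ + ∣ q ∣
  ∣p∪q∣≤∣p∣+∣q∣ []            []            = z≤n
  ∣p∪q∣≤∣p∣+∣q∣ (outside ∷ p) (outside ∷ q) = ∣p∪q∣≤∣p∣+∣q∣ p q
  ∣p∪q∣≤∣p∣+∣q∣ (outside ∷ p) (inside  ∷ q) =
    ≤-trans (s≤s (∣p∪q∣≤∣p∣+∣q∣ p q)) (≤-reflexive (sym (+-suc ∣ p ∣ ∣ q ∣)))
  ∣p∪q∣≤∣p∣+∣q∣ (inside  ∷ p) (outside ∷ q) = s≤s (∣p∪q∣≤∣p∣+∣q∣ p q)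
  ∣p∪q∣≤∣p∣+∣q∣ (inside  ∷ p) (inside  ∷ q) =
    s≤s (≤-trans (∣p∪q∣≤∣p∣+∣q∣ p q) (+-monoʳ-≤ ∣ p ∣ (n≤1+n ∣ q ∣)))

  ∣p∣≡∣p∩q∣+∣p─q∣ : ∀ (p q : Subset n) → ∣ p ∣ ≡ ∣ p ∩ q ∣ + ∣ p ─ q ∣
  ∣p∣≡∣p∩q∣+∣p─q∣ []            []            = refl
  ∣p∣≡∣p∩q∣+∣p─q∣ (outside ∷ p) (inside  ∷ q) = ∣p∣≡∣p∩q∣+∣p─q∣ p q
  ∣p∣≡∣p∩q∣+∣p─q∣ (outside ∷ p) (outside ∷ q) = ∣p∣≡∣p∩q∣+∣p─q∣ p q
  ∣p∣≡∣p∩q∣+∣p─q∣ (inside  ∷ p) (inside  ∷ q) = cong suc (∣p∣≡∣p∩q∣+∣p─q∣ p q)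
  ∣p∣≡∣p∩q∣+∣p─q∣ (inside  ∷ p) (outside ∷ q) =
    trans (cong suc (∣p∣≡∣p∩q∣+∣p─q∣ p q)) (sym (+-suc _ _))

  ⋃ᵢ : Subset m → (Fin m → Subset n) → Subset n
  ⋃ᵢ []            F = ⊥
  ⋃ᵢ (outside ∷ I) F = ⋃ᵢ I (F ∘ suc)
  ⋃ᵢ (inside  ∷ I) F = F zero ∪ ⋃ᵢ I (F ∘ suc)

  x∈⋃ᵢ⁺ : ∀ {I : Subset m} {F : Fin m → Subset n} {i x} → i ∈ I → x ∈ F i → x ∈ ⋃ᵢ I F
  x∈⋃ᵢ⁺ {I = inside ∷ I} here x∈Fi = x∈p∪q⁺ (inj₁ x∈Fi)
  x∈⋃ᵢ⁺ {I = inside ∷ I} (there i∈I) x∈Fi = x∈p∪q⁺ (inj₂ (x∈⋃ᵢ⁺ i∈I x∈Fi))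
  x∈⋃ᵢ⁺ {I = outside ∷ I} (there i∈I) x∈Fi = x∈⋃ᵢ⁺ i∈I x∈Fi

  x∈⋃ᵢ⁻ : ∀ (I : Subset m) (F : Fin m → Subset n) {x} → x ∈ ⋃ᵢ I F → ∃[ i ] (i ∈ I × x ∈ F i)
  x∈⋃ᵢ⁻ []            F x∈⋃ = contradiction x∈⋃ ∉⊥
  x∈⋃ᵢ⁻ (outside ∷ I) F x∈⋃ with x∈⋃ᵢ⁻ I (F ∘ suc) x∈⋃
  ... | i , i∈I , x∈Fi = suc i , there i∈I , x∈Fi
  x∈⋃ᵢ⁻ (inside  ∷ I) F x∈⋃ with x∈p∪q⁻ (F zero) (⋃ᵢ I (F ∘ suc)) x∈⋃
  ... | inj₁ x∈F0 = zero , here , x∈F0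
  ... | inj₂ x∈⋃′ with x∈⋃ᵢ⁻ I (F ∘ suc) x∈⋃′
  ...   | i , i∈I , x∈Fi = suc i , there i∈I , x∈Fi

  ∣⋃ᵢ∣≤ : ∀ {c} (I : Subset m) (F : Fin m → Subset n) →
          (∀ {i} → i ∈ I → ∣ F i ∣ ≤ c) → ∣ ⋃ᵢ I F ∣ ≤ c * ∣ I ∣
  ∣⋃ᵢ∣≤ {n = n} {c} [] F bound = ≤-trans (≤-reflexive (∣⊥∣≡0 n)) z≤n
  ∣⋃ᵢ∣≤ (outside ∷ I) F bound = ∣⋃ᵢ∣≤ I (F ∘ suc) (bound ∘ there)
  ∣⋃ᵢ∣≤ {c = c} (inside  ∷ I) F bound = begin
    ∣ F zero ∪ ⋃ᵢ I (F ∘ suc) ∣       ≤⟨ ∣p∪q∣≤∣p∣+∣q∣ (F zero) _ ⟩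
    ∣ F zero ∣ + ∣ ⋃ᵢ I (F ∘ suc) ∣   ≤⟨ +-mono-≤ (bound here) (∣⋃ᵢ∣≤ I (F ∘ suc) (bound ∘ there)) ⟩
    c + c * ∣ I ∣                     ≡⟨ *-suc c ∣ I ∣ ⟨
    c * suc ∣ I ∣                     ∎
    where open ≤-Reasoning

  indicator : Bool → ℕ
  indicator b = if b then 1 else 0

  ∣p∣≡∑ : ∀ (p : Subset n) → ∣ p ∣ ≡ ∑[ i < n ] indicator (lookup p i)
  ∣p∣≡∑ []            = refl
  ∣p∣≡∑ (inside  ∷ p) = cong suc (∣p∣≡∑ p)
  ∣p∣≡∑ (outside ∷ p) = ∣p∣≡∑ p

  *∣p∣≤∑ : ∀ {k} (p : Subset n) (f : Fin n → ℕ) →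
           (∀ {i} → i ∈ p → k ≤ f i) → k * ∣ p ∣ ≤ ∑[ i < n ] f i
  *∣p∣≤∑ {k = k} []            f bound = ≤-reflexive (*-zeroʳ k)
  *∣p∣≤∑         (outside ∷ p) f bound = ≤-trans (*∣p∣≤∑ p (f ∘ suc) (bound ∘ there)) (m≤n+m _ (f zero))
  *∣p∣≤∑ {k = k} (inside  ∷ p) f bound = begin
    k * suc ∣ p ∣         ≡⟨ *-suc k ∣ p ∣ ⟩
    k + k * ∣ p ∣         ≤⟨ +-mono-≤ (bound here) (*∣p∣≤∑ p (f ∘ suc) (bound ∘ there)) ⟩
    f zero + sum (f ∘ suc) ∎
    where open ≤-Reasoning

transpose : (Fin m → Subset n) → Fin n → Subset m
transpose F j = tabulate (λ i → lookup (F i) j)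

∑∣∣-transpose : ∀ (F : Fin m → Subset n) → ∑[ i < m ] ∣ F i ∣ ≡ ∑[ j < n ] ∣ transpose F j ∣
∑∣∣-transpose {m} {n} F = begin
  ∑[ i < m ] ∣ F i ∣                                ≡⟨ sum-cong-≗ (∣p∣≡∑ ∘ F) ⟩
  ∑[ i < m ] ∑[ j < n ] indicator (lookup (F i) j)  ≡⟨ ∑-comm (λ i j → indicator (lookup (F i) j)) ⟩
  ∑[ j < n ] ∑[ i < m ] indicator (lookup (F i) j)  ≡⟨ sum-cong-≗ ∣transpose∣≡∑ ⟨
  ∑[ j < n ] ∣ transpose F j ∣                      ∎
  where
  open ≡-Reasoning
  ∣transpose∣≡∑ : ∀ j → ∣ transpose F j ∣ ≡ ∑[ i < m ] indicator (lookup (F i) j)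
  ∣transpose∣≡∑ j =
    trans (∣p∣≡∑ (transpose F j)) (sum-cong-≗ (cong indicator ∘ lookup∘tabulate (λ i → lookup (F i) j)))

∑≤* : ∀ {t} (f : Fin n → ℕ) → (∀ i → f i ≤ t) → ∑[ i < n ] f i ≤ n * t
∑≤* {zero}  f bound = z≤n
∑≤* {suc n} f bound = +-mono-≤ (bound zero) (∑≤* (f ∘ suc) (bound ∘ suc))

x∈tabulate⌊⌋⁺ : ∀ {p} {P : Pred (Fin n) p} (P? : Decidable P) {x} → P x → x ∈ tabulate (⌊_⌋ ∘ P?)
x∈tabulate⌊⌋⁺ P? {x} Px = lookup⇒[]= x _ (begin
  lookup (tabulate (⌊_⌋ ∘ P?)) x  ≡⟨ lookup∘tabulate (⌊_⌋ ∘ P?) x ⟩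
  ⌊ P? x ⌋                         ≡⟨ isYes≗does (P? x) ⟩
  does (P? x)                      ≡⟨ dec-true (P? x) Px ⟩
  true                             ∎)
  where open ≡-Reasoning

x∈tabulate⌊⌋⁻ : ∀ {p} {P : Pred (Fin n) p} (P? : Decidable P) {x} → x ∈ tabulate (⌊_⌋ ∘ P?) → P x
x∈tabulate⌊⌋⁻ P? {x} x∈ with P? x | trans (sym (lookup∘tabulate (⌊_⌋ ∘ P?) x)) ([]=⇒lookup x∈)
... | yes Px | _  = Px
... | no  _  | ()

-- Greedy covering

Covers : (Fin m → Subset n) → Subset m → Subset n → Set
Covers C X U = ∀ {u} → u ∈ U → ∃[ x ] (x ∈ X × u ∈ C x)

Covers-mono : ∀ {C : Fin m → Subset n} {X Y U} → X ⊆ Y → Covers C X U → Covers C Y U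
Covers-mono X⊆Y cover u∈U with cover u∈U
... | x , x∈X , u∈Cx = x , X⊆Y x∈X , u∈Cx

record GreedyCover (C : Fin m → Subset n) (t : ℕ) (U : Subset n) : Set where
  field
    centres    : Subset m
    uncovered  : Subset n
    uncovered⊆ : uncovered ⊆ U
    covered    : ∀ {u} → u ∈ U → u ∉ uncovered → ∃[ c ] (c ∈ centres × u ∈ C c)
    cost       : suc t * ∣ centres ∣ + ∣ uncovered ∣ ≤ ∣ U ∣
    sparse     : ∀ c → ∣ uncovered ∩ C c ∣ ≤ t

  extendCover : ∀ {Y} → Covers C Y uncovered → Covers C (centres ∪ Y) U
  extendCover {Y} cover {u} u∈U with u ∈? uncovered
  ... | yes u∈ = Covers-mono (q⊆p∪q centres Y) cover u∈
  ... | no  u∉ with covered u∈U u∉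
  ...   | c , c∈ , u∈Cc = c , p⊆p∪q Y c∈ , u∈Cc

greedyCover : ∀ (C : Fin m → Subset n) t U → GreedyCover C t U
greedyCover {m} {n} C t U = go U (<-wellFounded ∣ U ∣)
  where
  stop : ∀ U → (∀ c → ∣ U ∩ C c ∣ ≤ t) → GreedyCover C t U
  stop U sparse = record
    { centres = ⊥ ; uncovered = U ; uncovered⊆ = id
    ; covered = λ u∈U u∉U → contradiction u∈U u∉U
    ; cost = ≤-reflexive (cong (_+ ∣ U ∣) (trans (cong (suc t *_) (∣⊥∣≡0 m)) (*-zeroʳ (suc t))))
    ; sparse = sparse }

  pick : ∀ U c → t < ∣ U ∩ C c ∣ → GreedyCover C t (U ─ C c) → GreedyCover C t U
  pick U c big rest = record
    { centres = ⁅ c ⁆ ∪ centres ; uncovered = uncovered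
    ; uncovered⊆ = p─q⊆p U (C c) ∘ uncovered⊆
    ; covered = covered′ ; cost = cost′ ; sparse = sparse }
    where
    open GreedyCover rest
    covered′ : ∀ {u} → u ∈ U → u ∉ uncovered → ∃[ d ] (d ∈ ⁅ c ⁆ ∪ centres × u ∈ C d)
    covered′ {u} u∈U u∉ with u ∈? C c
    ... | yes u∈Cc = c , x∈p∪q⁺ (inj₁ (x∈⁅x⁆ c)) , u∈Cc
    ... | no  u∉Cc with covered (x∈p∧x∉q⇒x∈p─q u∈U u∉Cc) u∉
    ...   | d , d∈ , u∈Cd = d , x∈p∪q⁺ (inj₂ d∈) , u∈Cd
    cost′ : suc t * ∣ ⁅ c ⁆ ∪ centres ∣ + ∣ uncovered ∣ ≤ ∣ U ∣
    cost′ = begin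
      suc t * ∣ ⁅ c ⁆ ∪ centres ∣ + ∣ uncovered ∣   ≤⟨ +-monoˡ-≤ _ (*-monoʳ-≤ (suc t) ∣⁅c⁆∪centres∣≤) ⟩
      suc t * (1 + ∣ centres ∣) + ∣ uncovered ∣     ≡⟨ cong (_+ ∣ uncovered ∣) (*-suc (suc t) _) ⟩
      suc t + suc t * ∣ centres ∣ + ∣ uncovered ∣   ≡⟨ +-assoc (suc t) _ _ ⟩
      suc t + (suc t * ∣ centres ∣ + ∣ uncovered ∣) ≤⟨ +-mono-≤ big cost ⟩
      ∣ U ∩ C c ∣ + ∣ U ─ C c ∣                    ≡⟨ ∣p∣≡∣p∩q∣+∣p─q∣ U (C c) ⟨
      ∣ U ∣                                         ∎
      where
      open ≤-Reasoning
      ∣⁅c⁆∪centres∣≤ : ∣ ⁅ c ⁆ ∪ centres ∣ ≤ 1 + ∣ centres ∣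
      ∣⁅c⁆∪centres∣≤ = ≤-trans (∣p∪q∣≤∣p∣+∣q∣ ⁅ c ⁆ centres) (≤-reflexive (cong (_+ ∣ centres ∣) (∣⁅x⁆∣≡1 c)))

  go : ∀ U → Acc _<_ ∣ U ∣ → GreedyCover C t U
  go U (acc smaller) with any? (λ c → t <? ∣ U ∩ C c ∣)
  ... | no  none        = stop U (λ c → ≮⇒≥ (none ∘ (c ,_)))
  ... | yes (c , big) = pick U c big (go (U ─ C c) (smaller shrinks))
    where
    shrinks : ∣ U ─ C c ∣ < ∣ U ∣
    shrinks = begin-strict
      ∣ U ─ C c ∣               <⟨ m<n+m _ (≤-trans (s≤s z≤n) big) ⟩
      ∣ U ∩ C c ∣ + ∣ U ─ C c ∣ ≡⟨ ∣p∣≡∣p∩q∣+∣p─q∣ U (C c) ⟨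
      ∣ U ∣                     ∎
      where open ≤-Reasoning

-- Maximal independent sets

module _ {p r} {P : Pred (Fin n) p} (P? : Decidable P)
         {R : Rel (Fin n) r} (R? : Decidable₂ R) (R-refl : Reflexive R) (R-sym : Symmetric R) where

  record MaximalIndependent (vs : List (Fin n)) : Set (p ⊔ r) where
    field
      set         : Subset n
      ⊆P          : ∀ {a} → a ∈ set → P a
      independent : ∀ {a b} → a ∈ set → b ∈ set → a ≢ b → ¬ R a b
      maximal     : ∀ {v} → v List.∈ vs → P v → ∃[ a ] (a ∈ set × R a v)

  private
    x∈⁅y⁆∪p⁻ : ∀ {x y} (p : Subset n) → x ∈ ⁅ y ⁆ ∪ p → x ≡ y ⊎ x ∈ p
    x∈⁅y⁆∪p⁻ {y = y} p x∈ = Sum.map₁ (x∈⁅y⁆⇒x≡y y) (x∈p∪q⁻ ⁅ y ⁆ p x∈)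

  maximalIndependent : ∀ vs → MaximalIndependent vs
  maximalIndependent []       = record
    { set = ⊥ ; ⊆P = λ a∈⊥ → contradiction a∈⊥ ∉⊥
    ; independent = λ a∈⊥ → contradiction a∈⊥ ∉⊥ ; maximal = λ () }
  maximalIndependent (v ∷ vs) = extend (maximalIndependent vs)
    where
    keep : (I : MaximalIndependent vs) → (P v → ∃[ a ] (a ∈ MaximalIndependent.set I × R a v)) →
           MaximalIndependent (v ∷ vs)
    keep I covers-v = record
      { set = set ; ⊆P = ⊆P ; independent = independent
      ; maximal = λ { (here refl) → covers-v ; (there w∈vs) → maximal w∈vs } }
      where open MaximalIndependent I

    add : (I : MaximalIndependent vs) → P v → ¬ (∃[ a ] (a ∈ MaximalIndependent.set I × R a v)) →
          MaximalIndependent (v ∷ vs)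
    add I Pv free = record
      { set = ⁅ v ⁆ ∪ set ; ⊆P = ⊆P′ ; independent = independent′ ; maximal = maximal′ }
      where
      open MaximalIndependent I
      ⊆P′ : ∀ {a} → a ∈ ⁅ v ⁆ ∪ set → P a
      ⊆P′ a∈ with x∈⁅y⁆∪p⁻ set a∈
      ... | inj₁ refl   = Pv
      ... | inj₂ a∈set = ⊆P a∈set
      independent′ : ∀ {a b} → a ∈ ⁅ v ⁆ ∪ set → b ∈ ⁅ v ⁆ ∪ set → a ≢ b → ¬ R a b
      independent′ a∈ b∈ a≢b Rab with x∈⁅y⁆∪p⁻ set a∈ | x∈⁅y⁆∪p⁻ set b∈
      ... | inj₁ refl   | inj₁ refl   = a≢b refl
      ... | inj₁ refl   | inj₂ b∈set = free (_ , b∈set , R-sym Rab)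
      ... | inj₂ a∈set | inj₁ refl   = free (_ , a∈set , Rab)
      ... | inj₂ a∈set | inj₂ b∈set = independent a∈set b∈set a≢b Rab
      maximal′ : ∀ {w} → w List.∈ v ∷ vs → P w → ∃[ a ] (a ∈ ⁅ v ⁆ ∪ set × R a w)
      maximal′ (here refl)  _  = v , x∈p∪q⁺ (inj₁ (x∈⁅x⁆ v)) , R-refl
      maximal′ (there w∈vs) Pw with maximal w∈vs Pw
      ... | a , a∈set , Raw = a , x∈p∪q⁺ (inj₂ a∈set) , Raw

    extend : MaximalIndependent vs → MaximalIndependent (v ∷ vs)
    extend I with P? v | any? (λ a → a ∈? MaximalIndependent.set I ×-dec R? a v)
    ... | yes Pv | no  free                = add I Pv free
    ... | yes Pv | yes (a , a∈set , Rav) = keep I (λ _ → a , a∈set , Rav)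
    ... | no ¬Pv | _                       = keep I (λ Pv → contradiction Pv ¬Pv)

-- Arithmetic

-- d₃ ≤ (n − u₁)/3 and d₂ ≤ (u₁ − u₂)/2, so d₃ + d₂ + u₂ ≤ n/3 + u₁/6 + u₂/2 ≤ 19n/42.
greedy-arith : ∀ n d₃ d₂ u₁ u₂ →
  3 * d₃ + u₁ ≤ n → 2 * d₂ + u₂ ≤ u₁ → 7 * u₁ ≤ n * 2 → 7 * u₂ ≤ n * 1 →
  42 * (d₃ + (d₂ + u₂)) ≤ 19 * n
greedy-arith n d₃ d₂ u₁ u₂ phase₃ phase₂ sparse₁ sparse₂ = begin
  42 * (d₃ + (d₂ + u₂))           ≤⟨ +-cancelˡ-≤ (14 * u₁ + 21 * u₂) _ _ weighted ⟩
  14 * n + 7 * u₁ + 3 * (7 * u₂)  ≤⟨ +-mono-≤ (+-monoʳ-≤ (14 * n) sparse₁) (*-monoʳ-≤ 3 sparse₂) ⟩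
  14 * n + n * 2 + 3 * (n * 1)    ≡⟨ solve (n ∷ []) ⟩
  19 * n                          ∎
  where
  open ≤-Reasoning
  weighted : 14 * u₁ + 21 * u₂ + 42 * (d₃ + (d₂ + u₂)) ≤
             14 * u₁ + 21 * u₂ + (14 * n + 7 * u₁ + 3 * (7 * u₂))
  weighted = begin
    14 * u₁ + 21 * u₂ + 42 * (d₃ + (d₂ + u₂))             ≡⟨ solve (d₃ ∷ d₂ ∷ u₁ ∷ u₂ ∷ []) ⟩
    14 * (3 * d₃ + u₁) + 21 * (2 * d₂ + u₂) + 42 * u₂
      ≤⟨ +-monoˡ-≤ (42 * u₂) (+-mono-≤ (*-monoʳ-≤ 14 phase₃) (*-monoʳ-≤ 21 phase₂)) ⟩
    14 * n + 21 * u₁ + 42 * u₂                            ≡⟨ solve (n ∷ u₁ ∷ u₂ ∷ []) ⟩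
    14 * u₁ + 21 * u₂ + (14 * n + 7 * u₁ + 3 * (7 * u₂))  ∎

packing-arith : ∀ n a δ → 149 * n ≤ 300 * δ → 42 * δ ≤ 294 * a + 19 * n → 41 * n ≤ 9800 * a
packing-arith n a δ lower upper = *-cancelˡ-≤ 9 (begin
  9 * (41 * n)    ≡⟨ solve (n ∷ []) ⟩
  369 * n         ≤⟨ *-monoˡ-≤ n (m≤m+n 369 189) ⟩
  558 * n         ≤⟨ +-cancelˡ-≤ (5700 * n) _ _ combined ⟩
  88200 * a       ≡⟨ solve (a ∷ []) ⟩
  9 * (9800 * a)  ∎)
  where
  open ≤-Reasoning
  combined : 5700 * n + 558 * n ≤ 5700 * n + 88200 * a
  combined = begin
    5700 * n + 558 * n        ≡⟨ solve (n ∷ []) ⟩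
    42 * (149 * n)            ≤⟨ *-monoʳ-≤ 42 lower ⟩
    42 * (300 * δ)            ≡⟨ solve (δ ∷ []) ⟩
    300 * (42 * δ)            ≤⟨ *-monoʳ-≤ 300 upper ⟩
    300 * (294 * a + 19 * n)  ≡⟨ solve (n ∷ a ∷ []) ⟩
    5700 * n + 88200 * a      ∎

-- Closed neighbourhoods

module _ {n : ℕ} (G : Graph n) where
  open Graph G using (adj?; irrefl) renaming (sym to Adj-sym)

  closedNbhd : Fin n → Subset n
  closedNbhd v = ⁅ v ⁆ ∪ N G v

  ∈closedNbhd⁺ : ∀ {v w} → InClosedNbhd G w v → w ∈ closedNbhd v
  ∈closedNbhd⁺ (inj₁ refl) = x∈p∪q⁺ (inj₁ (x∈⁅x⁆ _))
  ∈closedNbhd⁺ {v} (inj₂ v~w) = x∈p∪q⁺ (inj₂ (x∈tabulate⌊⌋⁺ (adj? v) v~w))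

  ∈closedNbhd⁻ : ∀ {v w} → w ∈ closedNbhd v → InClosedNbhd G w v
  ∈closedNbhd⁻ {v} = Sum.map (x∈⁅y⁆⇒x≡y v) (x∈tabulate⌊⌋⁻ (adj? v)) ∘ x∈p∪q⁻ ⁅ v ⁆ (N G v)

  v∈closedNbhd : ∀ {v} → v ∈ closedNbhd v
  v∈closedNbhd = ∈closedNbhd⁺ (inj₁ refl)

  closedNbhd-sym : ∀ {v w} → w ∈ closedNbhd v → v ∈ closedNbhd w
  closedNbhd-sym = ∈closedNbhd⁺ ∘ Sum.map sym Adj-sym ∘ ∈closedNbhd⁻

  ∣closedNbhd∣≤1+degree : ∀ v → ∣ closedNbhd v ∣ ≤ suc (degree G v)
  ∣closedNbhd∣≤1+degree v =
    ≤-trans (∣p∪q∣≤∣p∣+∣q∣ ⁅ v ⁆ (N G v)) (≤-reflexive (cong (_+ degree G v) (∣⁅x⁆∣≡1 v)))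

  NbhdsMeet : Fin n → Fin n → Set
  NbhdsMeet u v = Nonempty (closedNbhd u ∩ closedNbhd v)

  nbhdsMeet? : Decidable₂ NbhdsMeet
  nbhdsMeet? u v = nonempty? (closedNbhd u ∩ closedNbhd v)

  nbhdsMeet-refl : Reflexive NbhdsMeet
  nbhdsMeet-refl = _ , x∈p∩q⁺ (v∈closedNbhd , v∈closedNbhd)

  nbhdsMeet-sym : Symmetric NbhdsMeet
  nbhdsMeet-sym {u} {v} (w , w∈) = w , x∈p∩q⁺ (swap (x∈p∩q⁻ (closedNbhd u) (closedNbhd v) w∈))

  meetFree⇒closedNbhdsDisjoint : ∀ {A} → (∀ {a b} → a ∈ A → b ∈ A → a ≢ b → ¬ NbhdsMeet a b) →
    ClosedNbhdsDisjoint G A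
  meetFree⇒closedNbhdsDisjoint meetFree a∈A b∈A a≢b w (w~a , w~b) =
    meetFree a∈A b∈A a≢b (w , x∈p∩q⁺ (∈closedNbhd⁺ w~a , ∈closedNbhd⁺ w~b))

  closedNbhdsDisjoint⇒independent : ∀ {A} → ClosedNbhdsDisjoint G A → Independent G A
  closedNbhdsDisjoint⇒independent disjoint {u} {v} u∈A v∈A u~v =
    disjoint u∈A v∈A (λ { refl → irrefl u~v }) v (inj₂ u~v , inj₁ refl)

  transpose-U∩N≡N : ∀ {U u} → u ∈ U → transpose (λ w → U ∩ N G w) u ≡ N G u
  transpose-U∩N≡N {U} {u} u∈U = tabulate-cong λ w → begin
    lookup (U ∩ N G w) u           ≡⟨ lookup-zipWith _∧_ u U (N G w) ⟩
    lookup U u ∧ lookup (N G w) u  ≡⟨ cong₂ _∧_ ([]=⇒lookup u∈U) (lookup∘tabulate (⌊_⌋ ∘ adj? w) u) ⟩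
    ⌊ adj? w u ⌋                   ≡⟨ isYes≗does (adj? w u) ⟩
    does (adj? w u)                ≡⟨ does-⇔ (mk⇔ Adj-sym Adj-sym) (adj? w u) (adj? u w) ⟩
    does (adj? u w)                ≡⟨ isYes≗does (adj? u w) ⟨
    ⌊ adj? u w ⌋                   ∎
    where open ≡-Reasoning

  degree-double-count : ∀ {k t} (U : Subset n) → (∀ {u} → u ∈ U → k ≤ degree G u) →
    (∀ w → ∣ U ∩ closedNbhd w ∣ ≤ t) → k * ∣ U ∣ ≤ n * t
  degree-double-count {k} {t} U highDegree sparse = begin
    k * ∣ U ∣                                     ≤⟨ *∣p∣≤∑ U _ column-large ⟩
    ∑[ u < n ] ∣ transpose (λ w → U ∩ N G w) u ∣  ≡⟨ ∑∣∣-transpose (λ w → U ∩ N G w) ⟨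
    ∑[ w < n ] ∣ U ∩ N G w ∣                      ≤⟨ ∑≤* _ (λ w → ≤-trans (∣U∩N∣≤ w) (sparse w)) ⟩
    n * t                                         ∎
    where
    open ≤-Reasoning
    column-large : ∀ {u} → u ∈ U → k ≤ ∣ transpose (λ w → U ∩ N G w) u ∣
    column-large u∈U = subst (k ≤_) (cong ∣_∣ (sym (transpose-U∩N≡N u∈U))) (highDegree u∈U)
    ∣U∩N∣≤ : ∀ w → ∣ U ∩ N G w ∣ ≤ ∣ U ∩ closedNbhd w ∣
    ∣U∩N∣≤ w = p⊆q⇒∣p∣≤∣q∣ (x∈p∩q⁺ ∘ map₂ (x∈p∪q⁺ ∘ inj₂) ∘ x∈p∩q⁻ U (N G w))

-- A maximal 2-packing of low-degree vertices

module TwoPacking {n : ℕ} (G : Graph n) where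

  open MaximalIndependent
    (maximalIndependent (λ v → degree G v ≤? 6) (nbhdsMeet? G) (nbhdsMeet-refl G) (nbhdsMeet-sym G) (allFin n))
    renaming (set to A; ⊆P to A-lowDegree; independent to A-meetFree)
    public

  S : Subset n
  S = ⋃ᵢ A (closedNbhd G)

  U : Subset n
  U = ∁ (⋃ᵢ S (closedNbhd G))

  U-highDegree : ∀ {u} → u ∈ U → 7 ≤ degree G u
  U-highDegree {u} u∈U with degree G u ≤? 6
  ... | no  deg≰6 = ≰⇒> deg≰6
  ... | yes deg≤6 with maximal (∈-allFin u) deg≤6
  ...   | a , a∈A , x , x∈ with x∈p∩q⁻ (closedNbhd G a) (closedNbhd G u) x∈
  ...     | x∈N̄a , x∈N̄u =
    contradiction (x∈⋃ᵢ⁺ (x∈⋃ᵢ⁺ a∈A x∈N̄a) (closedNbhd-sym G x∈N̄u)) (x∈∁p⇒x∉p u∈U)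

  cover₃ : GreedyCover (closedNbhd G) 2 U
  cover₃ = greedyCover (closedNbhd G) 2 U

  open GreedyCover cover₃ using ()
    renaming (centres to D₃; uncovered to U′; uncovered⊆ to U′⊆U; cost to cost₃; sparse to sparse₃)

  cover₂ : GreedyCover (closedNbhd G) 1 U′
  cover₂ = greedyCover (closedNbhd G) 1 U′

  open GreedyCover cover₂ using ()
    renaming (centres to D₂; uncovered to U″; uncovered⊆ to U″⊆U′; cost to cost₂; sparse to sparse₂)

  D : Subset n
  D = S ∪ (D₃ ∪ (D₂ ∪ U″))

  U-covered : Covers (closedNbhd G) (D₃ ∪ (D₂ ∪ U″)) U
  U-covered = GreedyCover.extendCover cover₃ (GreedyCover.extendCover cover₂ U″-self-covered)
    where
    U″-self-covered : Covers (closedNbhd G) U″ U″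
    U″-self-covered u∈U″ = _ , u∈U″ , v∈closedNbhd G

  D-dominating : Dominating G D
  D-dominating w with w ∈? ⋃ᵢ S (closedNbhd G)
  ... | yes w∈ with x∈⋃ᵢ⁻ S (closedNbhd G) w∈
  ...   | s , s∈S , w∈N̄s = s , p⊆p∪q _ s∈S , ∈closedNbhd⁻ G w∈N̄s
  D-dominating w | no w∉ with U-covered (x∉p⇒x∈∁p w∉)
  ... | d , d∈ , w∈N̄d = d , q⊆p∪q S _ d∈ , ∈closedNbhd⁻ G w∈N̄d

  ∣S∣≤7∣A∣ : ∣ S ∣ ≤ 7 * ∣ A ∣
  ∣S∣≤7∣A∣ = ∣⋃ᵢ∣≤ A (closedNbhd G) λ {a} a∈A →
    ≤-trans (∣closedNbhd∣≤1+degree G a) (s≤s (A-lowDegree a∈A))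

  42∣D∣≤294∣A∣+19n : 42 * ∣ D ∣ ≤ 294 * ∣ A ∣ + 19 * n
  42∣D∣≤294∣A∣+19n = begin
    42 * ∣ D ∣                  ≤⟨ *-monoʳ-≤ 42 ∣D∣≤∣S∣+greedy ⟩
    42 * (∣ S ∣ + greedy)       ≡⟨ *-distribˡ-+ 42 ∣ S ∣ greedy ⟩
    42 * ∣ S ∣ + 42 * greedy    ≤⟨ +-mono-≤ (*-monoʳ-≤ 42 ∣S∣≤7∣A∣) 42greedy≤19n ⟩
    42 * (7 * ∣ A ∣) + 19 * n   ≡⟨ cong (_+ 19 * n) (*-assoc 42 7 ∣ A ∣) ⟨
    294 * ∣ A ∣ + 19 * n        ∎
    where
    open ≤-Reasoning
    greedy : ℕ
    greedy = ∣ D₃ ∣ + (∣ D₂ ∣ + ∣ U″ ∣)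
    ∣D∣≤∣S∣+greedy : ∣ D ∣ ≤ ∣ S ∣ + greedy
    ∣D∣≤∣S∣+greedy = ≤-trans (∣p∪q∣≤∣p∣+∣q∣ S _) (+-monoʳ-≤ ∣ S ∣
      (≤-trans (∣p∪q∣≤∣p∣+∣q∣ D₃ _) (+-monoʳ-≤ ∣ D₃ ∣ (∣p∪q∣≤∣p∣+∣q∣ D₂ U″))))
    42greedy≤19n : 42 * greedy ≤ 19 * n
    42greedy≤19n = greedy-arith n (∣ D₃ ∣) (∣ D₂ ∣) (∣ U′ ∣) (∣ U″ ∣)
      (≤-trans cost₃ (∣p∣≤n U)) cost₂
      (degree-double-count G U′ (U-highDegree ∘ U′⊆U) sparse₃)
      (degree-double-count G U″ (U-highDegree ∘ U′⊆U ∘ U″⊆U′) sparse₂)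

mainTheorem11 : (n : ℕ) (G : Graph n) →
    (∀ (D : Subset n) → Dominating G D → 149 * n ≤ 300 * ∣ D ∣) →
    ∃[ A ] (Independent G A × ClosedNbhdsDisjoint G A
    × (∀ {v} → v ∈ A → degree G v ≤ 6) × 41 * n ≤ 9800 * ∣ A ∣)
mainTheorem11 n G noSmallDominatingSet =
  A , closedNbhdsDisjoint⇒independent G disjoint , disjoint , A-lowDegree ,
  packing-arith n (∣ A ∣) (∣ D ∣) (noSmallDominatingSet D D-dominating) 42∣D∣≤294∣A∣+19n
  where
  open TwoPacking G
  disjoint : ClosedNbhdsDisjoint G A
  disjoint = meetFree⇒closedNbhdsDisjoint G A-meetFree
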